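{- Let $\mathcal{C}$ and $\mathcal{C}'$ be binary linear codes of lengths $n,n'\ge 7$ satisfying: (A1) no codeword of $\mathcal{C}$ or $\mathcal{C}^\perp$ has the form $0\cdots0\,x$ with $x$ a length-3 word of Hamming weight 1 or 2; (A2) no codeword of $\mathcal{C}'$ or $\mathcal{C}'^\perp$ has the form $x\,0\cdots0$ with $x$ a length-3 word of Hamming weight 1 or 2; (A3) $0\cdots0111\in\mathcal{C}$ and $1110\cdots0\in\mathcal{C}'$. Then (a) $\dim(\mathcal{C}\oplus_3\mathcal{C}')=\dim(\mathcal{C})+\dim(\mathcal{C}')-4$; (b) $d(\mathcal{C}\oplus_3\mathcal{C}')\le\min\{d(\mathcal{C}\setminus\{n-2,n-1,n\}),\ d(\mathcal{C}'\setminus\{1,2,3\})\}$.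
   Context: $\mathcal{C}\oplus_3\mathcal{C}'=\{(c_1,\dots,c_{n-3},c'_4,\dots,c'_{n'}): c\in\mathcal{C}, c'\in\mathcal{C}', (c_{n-2},c_{n-1},c_n)=(c'_1,c'_2,c'_3)\}$ (the 3-sum). For a code $\mathcal{D}$ and a set $J$ of coordinates, $\mathcal{D}\setminus J$ is the code obtained by shortening $\mathcal{D}$ at $J$: take the codewords of $\mathcal{D}$ that are zero on $J$ and delete the coordinates in $J$. $d(\cdot)$ denotes minimum Hamming distance. -}

module Defs where

open import Data.Bool using (Bool; true; false; _xor_)
open import Data.Nat using (ℕ; zero; suc; _+_; _≤_)
open import Data.Vec using (Vec; []; _∷_; _++_; replicate; zipWith; foldr)
open import Data.Maybe using (Maybe; just; nothing)
open import Data.Product using (Σ; _×_; _,_; ∃)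
open import Data.Sum using (_⊎_)
open import Data.Unit using (⊤)
open import Data.Empty using (⊥)
open import Relation.Nullary using (¬_)
open import Relation.Binary.PropositionalEquality using (_≡_)

Word : ℕ → Set
Word n = Vec Bool n

0w : ∀ {n} → Word n
0w = replicate _ false

1w : ∀ {n} → Word n
1w = replicate _ true

_⊕_ : ∀ {n} → Word n → Word n → Word n
_⊕_ = zipWith _xor_

_·_ : ∀ {n} → Bool → Word n → Word n
true  · x = x
false · x = 0w

dot : ∀ {n} → Word n → Word n → Bool
dot [] [] = false
dot (a ∷ x) (b ∷ y) = (a Data.Bool.∧ b) xor dot x y

weight : ∀ {n} → Word n → ℕ
weight [] = 0
weight (true ∷ x) = suc (weight x)
weight (false ∷ x) = weight x

-- A binary linear code of length n: an F₂-subspace of F₂ⁿ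
-- (over F₂, closure under addition and containing 0 suffices).
record LinearCode (n : ℕ) : Set₁ where
  field
    _∈C : Word n → Set
    zero∈ : 0w ∈C
    ⊕∈ : ∀ {x y} → x ∈C → y ∈C → (x ⊕ y) ∈C
open LinearCode public

Code : ℕ → Set₁
Code n = Word n → Set

dual : ∀ {n} → Code n → Code n
dual C x = ∀ c → C c → dot x c ≡ false

lincomb : ∀ {n k} → Vec Bool k → Vec (Word n) k → Word n
lincomb [] [] = 0w
lincomb (a ∷ as) (b ∷ bs) = (a · b) ⊕ lincomb as bs

AllIn : ∀ {n k} → Code n → Vec (Word n) k → Set
AllIn C [] = ⊤
AllIn C (b ∷ bs) = C b × AllIn C bs

HasDim : ∀ {n} → Code n → ℕ → Set
HasDim {n} C k = Σ (Vec (Word n) k) λ B →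
    AllIn C B
  × (∀ (a : Vec Bool k) → lincomb a B ≡ 0w → a ≡ 0w)
  × (∀ c → C c → Σ (Vec Bool k) λ a → lincomb a B ≡ c)

-- Extended naturals: nothing = ∞ (minimum distance of a code with no nonzero word)
ℕ∞ : Set
ℕ∞ = Maybe ℕ

_≤∞_ : ℕ∞ → ℕ∞ → Set
just a ≤∞ just b = a ≤ b
just a ≤∞ nothing = ⊤
nothing ≤∞ just b = ⊥
nothing ≤∞ nothing = ⊤

min∞ : ℕ∞ → ℕ∞ → ℕ∞
min∞ nothing y = y
min∞ (just a) nothing = just a
min∞ (just a) (just b) = just (a Data.Nat.⊓ b)

-- d is the minimum Hamming distance (= minimum nonzero weight, D linear) of D
IsMinDist : ∀ {n} → Code n → ℕ∞ → Set
IsMinDist D nothing = ∀ c → D c → c ≡ 0w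
IsMinDist D (just d) =
    (Σ _ λ c → D c × ¬ (c ≡ 0w) × weight c ≡ d)
  × (∀ c → D c → ¬ (c ≡ 0w) → d ≤ weight c)

threeSum : ∀ {m m'} → Code (m + 3) → Code (3 + m') → Code (m + m')
threeSum {m} {m'} C C' w =
  Σ (Word m) λ u → Σ (Word m') λ v → Σ (Word 3) λ x →
    (u ++ v ≡ w) × C (u ++ x) × C' (x ++ v)

shortenLast3 : ∀ {m} → Code (m + 3) → Code m
shortenLast3 C y = C (y ++ 0w)

shortenFirst3 : ∀ {m'} → Code (3 + m') → Code m'
shortenFirst3 C' y = C' (0w ++ y)

Wt12 : Word 3 → Set
Wt12 x = weight x ≡ 1 ⊎ weight x ≡ 2

NoTailWt12 : ∀ {m} → Code (m + 3) → Set
NoTailWt12 {m} D = ∀ (x : Word 3) → Wt12 x → ¬ D (0w {m} ++ x)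

NoHeadWt12 : ∀ {m'} → Code (3 + m') → Set
NoHeadWt12 {m'} D = ∀ (x : Word 3) → Wt12 x → ¬ D (x ++ 0w {m'})

-- Let G consist of the words c ++ c' of C ⊗ C' in which the last three coordinates of c agree with the
-- first three of c'. (A1) for C^⊥ together with 0⋯0111 ∈ C makes the map C → F₂³, c ↦ (last three
-- coordinates), onto, so G has codimension 3 in C ⊗ C'. The 3-sum is the image of G under deleting the six
-- glued coordinates; by (A1) for C the kernel of this map on G is {0, 0⋯0111 1110⋯0}, a nonzero word of G
-- by (A3), so one more dimension is lost. For (b), padding a word of either shortened code with zeros
-- gives a word of the 3-sum of the same weight.

module Submission where

open import Defs
open import Data.Bool using (Bool; true; false; _xor_; _∧_)
open import Data.Bool.Properties
  using (xor-assoc; xor-comm; xor-identityˡ; xor-identityʳ; xor-same; xor-∧-commutativeRing;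
         ∧-zeroʳ; ∧-identityʳ)
open import Algebra.Bundles using (CommutativeRing)
open import Algebra.Properties.CommutativeSemigroup
  (CommutativeRing.+-commutativeSemigroup xor-∧-commutativeRing) using () renaming (interchange to xor-interchange)
open import Data.Nat using (ℕ; zero; suc; _+_; _≤_)
open import Data.Nat.Properties using (+-comm; ⊓-glb)
open import Data.Vec using (Vec; []; _∷_; _++_; map; take; drop; head; tail)
open import Data.Vec.Properties
  using (zipWith-assoc; zipWith-identityˡ; zipWith-identityʳ; zipWith-++;
         take-zipWith; drop-zipWith; take++drop≡id; ++-injectiveˡ; ++-injectiveʳ; ++-injective;
         ∷-injectiveʳ)
open import Data.Maybe using (just; nothing)
open import Data.Product using (Σ; ∃-syntax; Σ-syntax; _×_; _,_; proj₁; proj₂)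
open import Data.Sum using (_⊎_; inj₁; inj₂)
open import Data.Unit using (tt)
open import Data.Empty using (⊥-elim)
open import Relation.Nullary using (¬_)
open import Relation.Unary using (_⊆_; _≐_; _∩_)
open import Relation.Unary.Properties using (≐-refl; ≐-sym; ≐-trans)
open import Relation.Binary.PropositionalEquality
open import Function using (_∘_)

private variable
  n p k r : ℕ

⊕-assoc : (x y z : Word n) → (x ⊕ y) ⊕ z ≡ x ⊕ (y ⊕ z)
⊕-assoc = zipWith-assoc xor-assoc

⊕-identityˡ : (x : Word n) → 0w ⊕ x ≡ x
⊕-identityˡ = zipWith-identityˡ xor-identityˡ

⊕-identityʳ : (x : Word n) → x ⊕ 0w ≡ x
⊕-identityʳ = zipWith-identityʳ xor-identityʳ

⊕-self : (x : Word n) → x ⊕ x ≡ 0w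
⊕-self []      = refl
⊕-self (a ∷ x) = cong₂ _∷_ (xor-same a) (⊕-self x)

⊕-cancelʳ : (x y : Word n) → (x ⊕ y) ⊕ y ≡ x
⊕-cancelʳ x y = begin
  (x ⊕ y) ⊕ y ≡⟨ ⊕-assoc x y y ⟩
  x ⊕ (y ⊕ y) ≡⟨ cong (x ⊕_) (⊕-self y) ⟩
  x ⊕ 0w      ≡⟨ ⊕-identityʳ x ⟩
  x           ∎
  where open ≡-Reasoning

⊕≡0w⇒≡ : (x y : Word n) → x ⊕ y ≡ 0w → x ≡ y
⊕≡0w⇒≡ x y eq = begin
  x           ≡⟨ sym (⊕-cancelʳ x y) ⟩
  (x ⊕ y) ⊕ y ≡⟨ cong (_⊕ y) eq ⟩
  0w ⊕ y      ≡⟨ ⊕-identityˡ y ⟩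
  y           ∎
  where open ≡-Reasoning

⊕-interchange : (x y z w : Word n) → (x ⊕ y) ⊕ (z ⊕ w) ≡ (x ⊕ z) ⊕ (y ⊕ w)
⊕-interchange []      []      []      []      = refl
⊕-interchange (a ∷ x) (b ∷ y) (c ∷ z) (d ∷ w) =
  cong₂ _∷_ (xor-interchange a b c d) (⊕-interchange x y z w)

xor-·-distrib : ∀ a b (x : Word n) → (a xor b) · x ≡ (a · x) ⊕ (b · x)
xor-·-distrib true  true  x = sym (⊕-self x)
xor-·-distrib true  false x = sym (⊕-identityʳ x)
xor-·-distrib false b     x = sym (⊕-identityˡ (b · x))

++-⊕ : ∀ {m} (u u' : Word m) (v v' : Word n) → (u ++ v) ⊕ (u' ++ v') ≡ (u ⊕ u') ++ (v ⊕ v')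
++-⊕ u u' v v' = zipWith-++ _xor_ u v u' v'

0w-++ : ∀ m → 0w {m + n} ≡ 0w {m} ++ 0w {n}
0w-++ zero    = refl
0w-++ (suc m) = cong (false ∷_) (0w-++ m)

take-++ : ∀ {m} (u : Word m) (v : Word n) → take m (u ++ v) ≡ u
take-++ {m = m} u v = ++-injectiveˡ _ u (take++drop≡id m (u ++ v))

drop-++ : ∀ {m} (u : Word m) (v : Word n) → drop m (u ++ v) ≡ v
drop-++ {m = m} u v = ++-injectiveʳ _ u (take++drop≡id m (u ++ v))

take-⊕ : ∀ m (x y : Word (m + n)) → take m (x ⊕ y) ≡ take m x ⊕ take m y
take-⊕ m = take-zipWith _xor_

drop-⊕ : ∀ m (x y : Word (m + n)) → drop m (x ⊕ y) ≡ drop m x ⊕ drop m y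
drop-⊕ m = drop-zipWith _xor_

dot-⊕ʳ : (y x z : Word n) → dot y (x ⊕ z) ≡ dot y x xor dot y z
dot-⊕ʳ [] [] [] = refl
dot-⊕ʳ (true  ∷ y) (a ∷ x) (b ∷ z) =
  trans (cong ((a xor b) xor_) (dot-⊕ʳ y x z)) (xor-interchange a b _ _)
dot-⊕ʳ (false ∷ y) (a ∷ x) (b ∷ z) = dot-⊕ʳ y x z

dot-0wˡ : (x : Word n) → dot 0w x ≡ false
dot-0wˡ []      = refl
dot-0wˡ (_ ∷ x) = dot-0wˡ x

dot-++ : ∀ {m} (u u' : Word m) (v v' : Word n) → dot (u ++ v) (u' ++ v') ≡ dot u u' xor dot v v'
dot-++ []      []        v v' = refl
dot-++ (a ∷ u) (a' ∷ u') v v' =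
  trans (cong ((a ∧ a') xor_) (dot-++ u u' v v')) (sym (xor-assoc (a ∧ a') _ _))

dot-0w++ : ∀ m (y : Word n) (w : Word (m + n)) → dot (0w {m} ++ y) w ≡ dot y (drop m w)
dot-0w++ m y w = begin
  dot (0w ++ y) w                           ≡⟨ cong (dot (0w ++ y)) (sym (take++drop≡id m w)) ⟩
  dot (0w ++ y) (take m w ++ drop m w)      ≡⟨ dot-++ 0w (take m w) y (drop m w) ⟩
  dot 0w (take m w) xor dot y (drop m w)    ≡⟨ cong (_xor dot y (drop m w)) (dot-0wˡ (take m w)) ⟩
  dot y (drop m w)                          ∎
  where open ≡-Reasoning

IsLinear : (Word n → Word p) → Set
IsLinear π = ∀ x y → π (x ⊕ y) ≡ π x ⊕ π y

IsLinearFunctional : (Word n → Bool) → Set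
IsLinearFunctional ℓ = ∀ x y → ℓ (x ⊕ y) ≡ ℓ x xor ℓ y

linear-0w : (π : Word n → Word p) → IsLinear π → π 0w ≡ 0w
linear-0w π lin = begin
  π 0w                 ≡⟨ sym (⊕-cancelʳ (π 0w) (π 0w)) ⟩
  (π 0w ⊕ π 0w) ⊕ π 0w ≡⟨ cong (_⊕ π 0w) (sym (lin 0w 0w)) ⟩
  π (0w ⊕ 0w) ⊕ π 0w   ≡⟨ cong (λ t → π t ⊕ π 0w) (⊕-self 0w) ⟩
  π 0w ⊕ π 0w          ≡⟨ ⊕-self (π 0w) ⟩
  0w                   ∎
  where open ≡-Reasoning

functional-0w : (ℓ : Word n → Bool) → IsLinearFunctional ℓ → ℓ 0w ≡ false
functional-0w ℓ lin = begin
  ℓ 0w             ≡⟨ cong ℓ (sym (⊕-self 0w)) ⟩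
  ℓ (0w ⊕ 0w)      ≡⟨ lin 0w 0w ⟩
  ℓ 0w xor ℓ 0w    ≡⟨ xor-same (ℓ 0w) ⟩
  false            ∎
  where open ≡-Reasoning

linear-· : (π : Word n → Word p) → IsLinear π → ∀ a x → π (a · x) ≡ a · π x
linear-· π lin true  x = refl
linear-· π lin false x = linear-0w π lin

lincomb-map : (π : Word n → Word p) → IsLinear π → (α : Vec Bool k) (B : Vec (Word n) k) →
              π (lincomb α B) ≡ lincomb α (map π B)
lincomb-map π lin []      []      = linear-0w π lin
lincomb-map π lin (a ∷ α) (b ∷ B) =
  trans (lin (a · b) (lincomb α B)) (cong₂ _⊕_ (linear-· π lin a b) (lincomb-map π lin α B))

lincomb-0w : (B : Vec (Word n) k) → lincomb 0w B ≡ 0w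
lincomb-0w []      = refl
lincomb-0w (b ∷ B) = trans (⊕-identityˡ _) (lincomb-0w B)

lincomb-⊕ : (α α' : Vec Bool k) (B : Vec (Word n) k) → lincomb (α ⊕ α') B ≡ lincomb α B ⊕ lincomb α' B
lincomb-⊕ []      []        []      = sym (⊕-self 0w)
lincomb-⊕ (a ∷ α) (a' ∷ α') (b ∷ B) =
  trans (cong₂ _⊕_ (xor-·-distrib a a' b) (lincomb-⊕ α α' B)) (⊕-interchange _ _ _ _)

lincomb-++ : ∀ {k'} (α : Vec Bool k) (α' : Vec Bool k') (B : Vec (Word n) k) (B' : Vec (Word n) k') →
             lincomb (α ++ α') (B ++ B') ≡ lincomb α B ⊕ lincomb α' B'
lincomb-++ []      α' []      B' = sym (⊕-identityˡ _)
lincomb-++ (a ∷ α) α' (b ∷ B) B' =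
  trans (cong ((a · b) ⊕_) (lincomb-++ α α' B B')) (sym (⊕-assoc _ _ _))

Independent : Vec (Word n) k → Set
Independent B = ∀ α → lincomb α B ≡ 0w → α ≡ 0w

lincomb-injective : (B : Vec (Word n) k) → Independent B → ∀ α α' → lincomb α B ≡ lincomb α' B → α ≡ α'
lincomb-injective B ind α α' eq =
  ⊕≡0w⇒≡ α α' (ind (α ⊕ α') (trans (lincomb-⊕ α α' B) (trans (cong (_⊕ lincomb α' B) eq) (⊕-self _))))

-- Spans and dimension

Span : Vec (Word n) k → Code n
Span B w = ∃[ α ] lincomb α B ≡ w

Image : (Word n → Word p) → Code n → Code p
Image {n} π D y = Σ[ w ∈ Word n ] D w × π w ≡ y

Adjoin : Word n → Code n → Code n
Adjoin {n} v X w = Σ[ a ∈ Bool ] Σ[ x ∈ Word n ] X x × (a · v) ⊕ x ≡ w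

-- HasDim with the spanning condition strengthened to D ≐ Span B; this forces D to be linear.
Dim : Code n → ℕ → Set
Dim {n} D k = Σ[ B ∈ Vec (Word n) k ] Independent B × D ≐ Span B

lincomb-∈ : (C : LinearCode n) (B : Vec (Word n) k) → AllIn (_∈C C) B → ∀ α → _∈C C (lincomb α B)
lincomb-∈ C []      _          []      = zero∈ C
lincomb-∈ C (b ∷ B) (Cb , CB) (a ∷ α) = ⊕∈ C (scaled a) (lincomb-∈ C B CB α)
  where
  scaled : ∀ a → _∈C C (a · b)
  scaled true  = Cb
  scaled false = zero∈ C

AllIn-lincomb : (D : Code n) (B : Vec (Word n) k) → (∀ α → D (lincomb α B)) → AllIn D B
AllIn-lincomb D []      _   = tt
AllIn-lincomb D (b ∷ B) DB =
  subst D (trans (cong (b ⊕_) (lincomb-0w B)) (⊕-identityʳ b)) (DB (true ∷ 0w)) ,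
  AllIn-lincomb D B (λ α → subst D (⊕-identityˡ _) (DB (false ∷ α)))

HasDim⇒Dim : (C : LinearCode n) → HasDim (_∈C C) k → Dim (_∈C C) k
HasDim⇒Dim C (B , CB , ind , spans) =
  B , ind , (λ {w} → spans w) , λ { (α , refl) → lincomb-∈ C B CB α }

Dim⇒HasDim : {D : Code n} → Dim D k → HasDim D k
Dim⇒HasDim {D = D} (B , ind , D⊆ , ⊆D) =
  B , AllIn-lincomb D B (λ α → ⊆D (α , refl)) , ind , λ _ → D⊆

Dim-cong : {D D' : Code n} → D ≐ D' → Dim D k → Dim D' k
Dim-cong D≐D' (B , ind , D≐B) = B , ind , ≐-trans (≐-sym D≐D') D≐B

Dim-⊕ : {D : Code n} → Dim D k → ∀ {x y} → D x → D y → D (x ⊕ y)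
Dim-⊕ (B , _ , D⊆ , ⊆D) Dx Dy with D⊆ Dx | D⊆ Dy
... | α , refl | β , refl = ⊆D (α ⊕ β , lincomb-⊕ α β B)

Dim-0w : {D : Code n} → Dim D k → D 0w
Dim-0w (B , _ , _ , ⊆D) = ⊆D (0w , lincomb-0w B)

Image-cong : (π : Word n → Word p) {D D' : Code n} → D ≐ D' → Image π D ≐ Image π D'
Image-cong π (D⊆ , ⊆D) = (λ (w , Dw , e) → w , D⊆ Dw , e) , (λ (w , Dw , e) → w , ⊆D Dw , e)

Dim-image-injective : (π : Word n → Word p) → IsLinear π → {X : Code n} → Dim X k →
                      (∀ {x} → X x → π x ≡ 0w → x ≡ 0w) → Dim (Image π X) k
Dim-image-injective π lin {X} (B , ind , X⊆ , ⊆X) inj = map π B , ind' , image⊆ , ⊆image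
  where
  ind' : Independent (map π B)
  ind' α eq = ind α (inj (⊆X (α , refl)) (trans (lincomb-map π lin α B) eq))
  image⊆ : Image π X ⊆ Span (map π B)
  image⊆ (x , Xx , refl) with X⊆ Xx
  ... | α , refl = α , sym (lincomb-map π lin α B)
  ⊆image : Span (map π B) ⊆ Image π X
  ⊆image (α , refl) = lincomb α B , ⊆X (α , refl) , lincomb-map π lin α B

Dim-adjoin : {X : Code n} {v : Word n} → Dim X r → ¬ X v → Dim (Adjoin v X) (suc r)
Dim-adjoin {X = X} {v = v} (B , ind , X⊆ , ⊆X) v∉X = v ∷ B , ind' , adjoin⊆ , ⊆adjoin
  where
  ind' : Independent (v ∷ B)
  ind' (true  ∷ α) eq = ⊥-elim (v∉X (⊆X (α , sym (⊕≡0w⇒≡ v _ eq))))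
  ind' (false ∷ α) eq = cong (false ∷_) (ind α (trans (sym (⊕-identityˡ _)) eq))
  adjoin⊆ : Adjoin v X ⊆ Span (v ∷ B)
  adjoin⊆ (a , x , Xx , refl) with X⊆ Xx
  ... | α , refl = a ∷ α , refl
  ⊆adjoin : Span (v ∷ B) ⊆ Adjoin v X
  ⊆adjoin (a ∷ α , refl) = a , lincomb α B , ⊆X (α , refl) , refl

∷-independent : ∀ {b : Word n} {B : Vec (Word n) k} → Independent (b ∷ B) → Independent B
∷-independent ind α eq = ∷-injectiveʳ (ind (false ∷ α) (trans (⊕-identityˡ _) eq))

-- Dropping b, whose coefficient in the kernel vector is 1, loses nothing from the image.
Span-image-pivot : (π : Word n → Word p) → IsLinear π → (b : Word n) (B : Vec (Word n) k) →
                   Independent (b ∷ B) → (ζ : Vec Bool k) → π (lincomb (true ∷ ζ) (b ∷ B)) ≡ 0w →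
                   (∀ α → π (lincomb α (b ∷ B)) ≡ 0w → α ≡ 0w ⊎ α ≡ true ∷ ζ) →
                   Dim (Image π (Span (b ∷ B))) k
Span-image-pivot π lin b B ind ζ πζ ker =
  Dim-cong image-≐ (Dim-image-injective π lin (B , ∷-independent ind , ≐-refl) injective)
  where
  injective : ∀ {x} → Span B x → π x ≡ 0w → x ≡ 0w
  injective (α , refl) πx with ker (false ∷ α) (trans (cong π (⊕-identityˡ _)) πx)
  ... | inj₁ α≡0 = trans (cong (λ β → lincomb β B) (∷-injectiveʳ α≡0)) (lincomb-0w B)
  ... | inj₂ ()
  shift : ∀ α → π (lincomb (α ⊕ (true ∷ ζ)) (b ∷ B)) ≡ π (lincomb α (b ∷ B))
  shift α = begin
    π (lincomb (α ⊕ (true ∷ ζ)) (b ∷ B))                 ≡⟨ cong π (lincomb-⊕ α _ (b ∷ B)) ⟩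
    π (lincomb α (b ∷ B) ⊕ lincomb (true ∷ ζ) (b ∷ B))     ≡⟨ lin _ _ ⟩
    π (lincomb α (b ∷ B)) ⊕ π (lincomb (true ∷ ζ) (b ∷ B)) ≡⟨ cong (π (lincomb α (b ∷ B)) ⊕_) πζ ⟩
    π (lincomb α (b ∷ B)) ⊕ 0w                            ≡⟨ ⊕-identityʳ _ ⟩
    π (lincomb α (b ∷ B))                                 ∎
    where open ≡-Reasoning
  image-≐ : Image π (Span B) ≐ Image π (Span (b ∷ B))
  proj₁ image-≐ (_ , (α , refl) , refl) = lincomb α B , (false ∷ α , ⊕-identityˡ _) , refl
  proj₂ image-≐ (_ , (false ∷ α , refl) , refl) = lincomb α B , (α , refl) , cong π (sym (⊕-identityˡ _))
  proj₂ image-≐ (_ , (true ∷ α , refl) , refl) =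
    lincomb (α ⊕ ζ) B , (α ⊕ ζ , refl) , trans (cong π (sym (⊕-identityˡ _))) (shift (true ∷ α))

-- Induction up to the first basis vector with a nonzero coefficient in the kernel vector ζ.
Span-image : (π : Word n → Word p) → IsLinear π → (B : Vec (Word n) k) → Independent B →
             (ζ : Vec Bool k) → ¬ ζ ≡ 0w → π (lincomb ζ B) ≡ 0w →
             (∀ α → π (lincomb α B) ≡ 0w → α ≡ 0w ⊎ α ≡ ζ) →
             ∃[ r ] suc r ≡ k × Dim (Image π (Span B)) r
Span-image π lin []      ind []          ζ≢0 _  _   = ⊥-elim (ζ≢0 refl)
Span-image π lin (b ∷ B) ind (true  ∷ ζ) _   πζ ker = _ , refl , Span-image-pivot π lin b B ind ζ πζ ker
Span-image π lin (b ∷ B) ind (false ∷ ζ) ζ≢0 πζ ker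
  with Span-image π lin B (∷-independent ind) ζ (λ ζ≡0 → ζ≢0 (cong (false ∷_) ζ≡0))
                  (trans (cong π (sym (⊕-identityˡ _))) πζ) ker₀
  where
  ker₀ : ∀ α → π (lincomb α B) ≡ 0w → α ≡ 0w ⊎ α ≡ ζ
  ker₀ α πα with ker (false ∷ α) (trans (cong π (⊕-identityˡ _)) πα)
  ... | inj₁ e = inj₁ (∷-injectiveʳ e)
  ... | inj₂ e = inj₂ (∷-injectiveʳ e)
... | r , refl , dim = suc r , refl , Dim-cong image-≐ (Dim-adjoin dim πb∉)
  where
  π-step : ∀ a w → π ((a · b) ⊕ w) ≡ (a · π b) ⊕ π w
  π-step a w = trans (lin _ _) (cong (_⊕ π w) (linear-· π lin a b))
  πb∉ : ¬ Image π (Span B) (π b)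
  πb∉ (_ , (α , refl) , πα≡πb)
    with ker (true ∷ α) (trans (π-step true _) (trans (cong (π b ⊕_) πα≡πb) (⊕-self (π b))))
  ... | inj₁ ()
  ... | inj₂ ()
  image-≐ : Adjoin (π b) (Image π (Span B)) ≐ Image π (Span (b ∷ B))
  proj₁ image-≐ (a , _ , (_ , (α , refl) , refl) , refl) = _ , (a ∷ α , refl) , π-step a _
  proj₂ image-≐ (_ , (a ∷ α , refl) , refl) = a , _ , (lincomb α B , (α , refl) , refl) , sym (π-step a _)

Dim-image : (π : Word n → Word p) → IsLinear π → {D : Code n} → Dim D k →
            ∀ {z} → D z → ¬ z ≡ 0w → π z ≡ 0w → (∀ {w} → D w → π w ≡ 0w → w ≡ 0w ⊎ w ≡ z) →
            ∃[ r ] suc r ≡ k × Dim (Image π D) r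
Dim-image π lin (B , ind , D⊆ , ⊆D) Dz z≢0 πz ker with D⊆ Dz
... | ζ , refl with Span-image π lin B ind ζ ζ≢0 πz ker'
  where
  ζ≢0 : ¬ ζ ≡ 0w
  ζ≢0 ζ≡0 = z≢0 (trans (cong (λ α → lincomb α B) ζ≡0) (lincomb-0w B))
  ker' : ∀ α → π (lincomb α B) ≡ 0w → α ≡ 0w ⊎ α ≡ ζ
  ker' α πα with ker (⊆D (α , refl)) πα
  ... | inj₁ e = inj₁ (ind α e)
  ... | inj₂ e = inj₂ (lincomb-injective B ind α ζ e)
... | r , eq , dim = r , eq , Dim-cong (Image-cong π (≐-sym (D⊆ , ⊆D))) dim

module _ {n} (ℓ : Word n → Bool) (lin : IsLinearFunctional ℓ) {c : Word n} (ℓc : ℓ c ≡ true) where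

  -- ρ projects onto ker ℓ along c; on a code containing c its kernel is {0, c}.
  private
    ρ : Word n → Word n
    ρ x = x ⊕ (ℓ x · c)

    ρ-linear : IsLinear ρ
    ρ-linear x y = begin
      (x ⊕ y) ⊕ (ℓ (x ⊕ y) · c)         ≡⟨ cong (λ a → (x ⊕ y) ⊕ (a · c)) (lin x y) ⟩
      (x ⊕ y) ⊕ ((ℓ x xor ℓ y) · c)     ≡⟨ cong ((x ⊕ y) ⊕_) (xor-·-distrib (ℓ x) (ℓ y) c) ⟩
      (x ⊕ y) ⊕ ((ℓ x · c) ⊕ (ℓ y · c)) ≡⟨ ⊕-interchange x y _ _ ⟩
      ρ x ⊕ ρ y                         ∎
      where open ≡-Reasoning

    c≢0 : ¬ c ≡ 0w
    c≢0 c≡0 with trans (sym ℓc) (trans (cong ℓ c≡0) (functional-0w ℓ lin))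
    ... | ()

    ρc≡0 : ρ c ≡ 0w
    ρc≡0 = trans (cong (λ a → c ⊕ (a · c)) ℓc) (⊕-self c)

    ρ-kernel : ∀ w → ρ w ≡ 0w → w ≡ 0w ⊎ w ≡ c
    ρ-kernel w ρw with ℓ w | ⊕≡0w⇒≡ w _ ρw
    ... | true  | w≡c = inj₂ w≡c
    ... | false | w≡0 = inj₁ w≡0

    ℓ-scaled : ∀ a → ℓ (a · c) ≡ a
    ℓ-scaled true  = ℓc
    ℓ-scaled false = functional-0w ℓ lin

    ρ-image : {D : Code n} → Dim D k → D c → Image ρ D ≐ D ∩ (λ w → ℓ w ≡ false)
    proj₁ (ρ-image {D = D} dim Dc) (w , Dw , refl) = Dim-⊕ dim Dw (scaled (ℓ w)) , (begin
      ℓ (w ⊕ (ℓ w · c))        ≡⟨ lin w _ ⟩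
      ℓ w xor ℓ (ℓ w · c)      ≡⟨ cong (ℓ w xor_) (ℓ-scaled (ℓ w)) ⟩
      ℓ w xor ℓ w              ≡⟨ xor-same (ℓ w) ⟩
      false                    ∎)
      where
      open ≡-Reasoning
      scaled : ∀ a → D (a · c)
      scaled true  = Dc
      scaled false = Dim-0w dim
    proj₂ (ρ-image dim Dc) {w} (Dw , ℓw) = w , Dw , trans (cong (λ a → w ⊕ (a · c)) ℓw) (⊕-identityʳ w)

  Dim-kernel-functional : {D : Code n} → Dim D k → D c → ∃[ r ] suc r ≡ k × Dim (D ∩ (λ w → ℓ w ≡ false)) r
  Dim-kernel-functional dim Dc with Dim-image ρ ρ-linear dim Dc c≢0 ρc≡0 (λ {w} _ → ρ-kernel w)
  ... | r , eq , dimρ = r , eq , Dim-cong (ρ-image dim Dc) dimρ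

head-⊕ : (x y : Word (suc n)) → head (x ⊕ y) ≡ head x xor head y
head-⊕ (a ∷ x) (b ∷ y) = refl

tail-⊕ : (x y : Word (suc n)) → tail (x ⊕ y) ≡ tail x ⊕ tail y
tail-⊕ (a ∷ x) (b ∷ y) = refl

Word0≡0w : (x : Word 0) → x ≡ 0w
Word0≡0w [] = refl

≡0w-head-tail : (x : Word (suc n)) → head x ≡ false → tail x ≡ 0w → x ≡ 0w
≡0w-head-tail (a ∷ x) = cong₂ _∷_

-- Cut out one coordinate of φ at a time.
Dim-kernel-surjective : (φ : Word n → Word p) → IsLinear φ → {D : Code n} → Dim D k →
                        (∀ y → Image φ D y) → ∃[ r ] p + r ≡ k × Dim (D ∩ (λ w → φ w ≡ 0w)) r
Dim-kernel-surjective {p = zero} φ lin dim onto =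
  _ , refl , Dim-cong ((λ Dw → Dw , Word0≡0w _) , proj₁) dim
Dim-kernel-surjective {p = suc p} φ lin {D} dim onto
  with onto (true ∷ 0w)
... | c , Dc , φc
  with Dim-kernel-functional (head ∘ φ) ℓ-linear (cong head φc) dim Dc
  where
  ℓ-linear : IsLinearFunctional (head ∘ φ)
  ℓ-linear x y = trans (cong head (lin x y)) (head-⊕ (φ x) (φ y))
... | r₁ , eq₁ , dim₁
  with Dim-kernel-surjective (tail ∘ φ) φ'-linear dim₁ onto'
  where
  φ'-linear : IsLinear (tail ∘ φ)
  φ'-linear x y = trans (cong tail (lin x y)) (tail-⊕ (φ x) (φ y))
  onto' : ∀ y → Image (tail ∘ φ) (D ∩ (λ w → head (φ w) ≡ false)) y
  onto' y with onto (false ∷ y)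
  ... | w , Dw , φw = w , (Dw , cong head φw) , cong tail φw
... | r , eq , dim' = r , trans (cong suc eq) eq₁ , Dim-cong kernel-≐ dim'
  where
  kernel-≐ : (D ∩ (λ w → head (φ w) ≡ false)) ∩ (λ w → tail (φ w) ≡ 0w) ≐ D ∩ (λ w → φ w ≡ 0w)
  proj₁ kernel-≐ ((Dw , hw) , tw) = Dw , ≡0w-head-tail _ hw tw
  proj₂ kernel-≐ (Dw , φw) = (Dw , cong head φw) , cong tail φw

_⊗_ : ∀ {m} → Code m → Code n → Code (m + n)
(_⊗_ {m = m} C C') w = C (take m w) × C' (drop m w)

++-0w-linear : ∀ {m} → IsLinear (λ (x : Word m) → x ++ 0w {n})
++-0w-linear x y = sym (trans (++-⊕ x y 0w 0w) (cong ((x ⊕ y) ++_) (⊕-self 0w)))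

0w-++-linear : ∀ {m} → IsLinear (λ (x : Word n) → 0w {m} ++ x)
0w-++-linear x y = sym (trans (++-⊕ 0w 0w x y) (cong (_++ (x ⊕ y)) (⊕-self 0w)))

lincomb-⊗ : ∀ {m k'} (α : Vec Bool k) (α' : Vec Bool k') (B : Vec (Word m) k) (B' : Vec (Word n) k') →
            lincomb (α ++ α') (map (_++ 0w) B ++ map (0w ++_) B') ≡ lincomb α B ++ lincomb α' B'
lincomb-⊗ α α' B B' = begin
  lincomb (α ++ α') (map (_++ 0w) B ++ map (0w ++_) B')        ≡⟨ lincomb-++ α α' _ _ ⟩
  lincomb α (map (_++ 0w) B) ⊕ lincomb α' (map (0w ++_) B')    ≡⟨ cong₂ _⊕_ (sym (lincomb-map _ ++-0w-linear α B))
                                                                            (sym (lincomb-map _ 0w-++-linear α' B')) ⟩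
  (lincomb α B ++ 0w) ⊕ (0w ++ lincomb α' B')                  ≡⟨ ++-⊕ (lincomb α B) 0w 0w (lincomb α' B') ⟩
  (lincomb α B ⊕ 0w) ++ (0w ⊕ lincomb α' B')                   ≡⟨ cong₂ _++_ (⊕-identityʳ (lincomb α B)) (⊕-identityˡ (lincomb α' B')) ⟩
  lincomb α B ++ lincomb α' B'                                 ∎
  where open ≡-Reasoning

Dim-⊗ : ∀ {m k'} {C : Code m} {C' : Code n} → Dim C k → Dim C' k' → Dim (C ⊗ C') (k + k')
Dim-⊗ {k = k} {m = m} {k'} {C = C} {C'} (B , ind , C⊆ , ⊆C) (B' , ind' , C'⊆ , ⊆C') =
  map (_++ 0w) B ++ map (0w ++_) B' , ind⊗ , ⊗⊆ , ⊆⊗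
  where
  lincomb-split : ∀ α → lincomb α (map (_++ 0w) B ++ map (0w ++_) B') ≡ lincomb (take k α) B ++ lincomb (drop k α) B'
  lincomb-split α = trans (cong (λ β → lincomb β _) (sym (take++drop≡id k α))) (lincomb-⊗ (take k α) (drop k α) B B')
  ind⊗ : Independent (map (_++ 0w) B ++ map (0w ++_) B')
  ind⊗ α eq with ++-injective (lincomb (take k α) B) 0w (trans (sym (lincomb-split α)) (trans eq (0w-++ m)))
  ... | eqₗ , eqᵣ = begin
    α                    ≡⟨ sym (take++drop≡id k α) ⟩
    take k α ++ drop k α ≡⟨ cong₂ _++_ (ind (take k α) eqₗ) (ind' (drop k α) eqᵣ) ⟩
    0w {k} ++ 0w {k'}    ≡⟨ sym (0w-++ k) ⟩
    0w                   ∎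
    where open ≡-Reasoning
  ⊗⊆ : C ⊗ C' ⊆ Span (map (_++ 0w) B ++ map (0w ++_) B')
  ⊗⊆ {w} (Cw , C'w) with C⊆ Cw | C'⊆ C'w
  ... | α , eα | α' , eα' = α ++ α' , trans (lincomb-⊗ α α' B B') (trans (cong₂ _++_ eα eα') (take++drop≡id m w))
  ⊆⊗ : Span (map (_++ 0w) B ++ map (0w ++_) B') ⊆ C ⊗ C'
  ⊆⊗ (α , refl) rewrite lincomb-split α =
    subst C (sym (take-++ (lincomb (take k α) B) _)) (⊆C (take k α , refl)) ,
    subst C' (sym (drop-++ (lincomb (take k α) B) _)) (⊆C' (drop k α , refl))

Nondegenerate : Code n → Set
Nondegenerate {n} I = ∀ y → ¬ y ≡ 0w → Σ[ s ∈ Word n ] I s × dot y s ≡ true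

shortenHead : LinearCode (suc n) → LinearCode n
shortenHead I = record { _∈C = λ t → _∈C I (false ∷ t) ; zero∈ = zero∈ I ; ⊕∈ = ⊕∈ I }

-- Apply nondegeneracy to (y·t₀)y, which is orthogonal to 1t₀; adding 1t₀ if needed clears the head.
shortenHead-nondegenerate : (I : LinearCode (suc n)) → Nondegenerate (_∈C I) →
                            ∀ {t₀} → _∈C I (true ∷ t₀) → Nondegenerate (_∈C (shortenHead I))
shortenHead-nondegenerate I nd {t₀} It₀ y y≢0
  with nd (dot y t₀ ∷ y) (λ e → y≢0 (∷-injectiveʳ e))
... | false ∷ t , Is , e = t , Is , trans (cong (_xor dot y t) (sym (∧-zeroʳ (dot y t₀)))) e
... | true  ∷ t , Is , e = t ⊕ t₀ , ⊕∈ I Is It₀ , (begin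
  dot y (t ⊕ t₀)             ≡⟨ dot-⊕ʳ y t t₀ ⟩
  dot y t xor dot y t₀       ≡⟨ xor-comm (dot y t) _ ⟩
  dot y t₀ xor dot y t       ≡⟨ cong (_xor dot y t) (sym (∧-identityʳ (dot y t₀))) ⟩
  (dot y t₀ ∧ true) xor dot y t ≡⟨ e ⟩
  true                       ∎)
  where open ≡-Reasoning

nondegenerate⇒full : (I : LinearCode n) → Nondegenerate (_∈C I) → ∀ e → _∈C I e
nondegenerate⇒full I nd [] = zero∈ I
nondegenerate⇒full I nd (b ∷ t) with nd (true ∷ 0w) (λ ())
... | true ∷ t₀ , It₀ , _ = with-head b
  where
  full₀ : ∀ t → _∈C I (false ∷ t)
  full₀ = nondegenerate⇒full (shortenHead I) (shortenHead-nondegenerate I nd It₀)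
  with-head : ∀ b → _∈C I (b ∷ t)
  with-head false = full₀ t
  with-head true  = subst (_∈C I) (cong (true ∷_) (⊕-cancelʳ t t₀)) (⊕∈ I (full₀ (t ⊕ t₀)) It₀)
... | false ∷ t₀ , _ , e with trans (sym (dot-0wˡ t₀)) e
...   | ()

functional-on-span? : (ℓ : Word n → Bool) → IsLinearFunctional ℓ → (B : Vec (Word n) k) →
                      (∃[ α ] ℓ (lincomb α B) ≡ true) ⊎ (∀ α → ℓ (lincomb α B) ≡ false)
functional-on-span? ℓ lin []      = inj₂ λ { [] → functional-0w ℓ lin }
functional-on-span? ℓ lin (b ∷ B) with ℓ b in ℓb | functional-on-span? ℓ lin B
... | true  | _ = inj₁ (true ∷ 0w , trans (cong ℓ (trans (cong (b ⊕_) (lincomb-0w B)) (⊕-identityʳ b))) ℓb)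
... | false | inj₁ (α , ℓα) = inj₁ (false ∷ α , trans (cong ℓ (⊕-identityˡ _)) ℓα)
... | false | inj₂ ℓ≡0 = inj₂ λ { (a ∷ α) → trans (lin _ _) (cong₂ _xor_ (ℓ-scaled a) (ℓ≡0 α)) }
  where
  ℓ-scaled : ∀ a → ℓ (a · b) ≡ false
  ℓ-scaled true  = ℓb
  ℓ-scaled false = functional-0w ℓ lin

Word3-cases : (x : Word 3) → x ≡ 0w ⊎ Wt12 x ⊎ x ≡ 1w
Word3-cases (false ∷ false ∷ false ∷ []) = inj₁ refl
Word3-cases (false ∷ false ∷ true  ∷ []) = inj₂ (inj₁ (inj₁ refl))
Word3-cases (false ∷ true  ∷ false ∷ []) = inj₂ (inj₁ (inj₁ refl))
Word3-cases (true  ∷ false ∷ false ∷ []) = inj₂ (inj₁ (inj₁ refl))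
Word3-cases (false ∷ true  ∷ true  ∷ []) = inj₂ (inj₁ (inj₂ refl))
Word3-cases (true  ∷ false ∷ true  ∷ []) = inj₂ (inj₁ (inj₂ refl))
Word3-cases (true  ∷ true  ∷ false ∷ []) = inj₂ (inj₁ (inj₂ refl))
Word3-cases (true  ∷ true  ∷ true  ∷ []) = inj₂ (inj₂ refl)

imageCode : (π : Word n → Word p) → IsLinear π → LinearCode n → LinearCode p
imageCode π lin C = record
  { _∈C  = Image π (_∈C C)
  ; zero∈ = 0w , zero∈ C , linear-0w π lin
  ; ⊕∈   = λ { (x , Cx , refl) (y , Cy , refl) → x ⊕ y , ⊕∈ C Cx Cy , lin x y }
  }

dot-0w++1w : ∀ m → dot (0w {m} ++ 1w {3}) (0w {m} ++ 1w {3}) ≡ true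
dot-0w++1w zero    = refl
dot-0w++1w (suc m) = dot-0w++1w m

-- A word 0⋯0y orthogonal to C is excluded by (A1) for C^⊥ if wt y ∈ {1,2}, and by 0⋯0111 ∈ C if y = 111.
drop-surjective : ∀ m (C : LinearCode (m + 3)) → Dim (_∈C C) k → NoTailWt12 (dual (_∈C C)) →
                  _∈C C (0w {m} ++ 1w) → ∀ e → Image (drop m) (_∈C C) e
drop-surjective m C (B , _ , C⊆ , ⊆C) A1d c111 =
  nondegenerate⇒full (imageCode (drop m) (drop-⊕ m) C) nondegenerate
  where
  nondegenerate : Nondegenerate (Image (drop m) (_∈C C))
  nondegenerate y y≢0 with functional-on-span? (dot (0w {m} ++ y)) (dot-⊕ʳ (0w {m} ++ y)) B
  ... | inj₁ (α , t) = drop m (lincomb α B) , (_ , ⊆C (α , refl) , refl) , trans (sym (dot-0w++ m y _)) t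
  ... | inj₂ ⊥C = ⊥-elim (excluded (Word3-cases y))
    where
    orthogonal : dual (_∈C C) (0w ++ y)
    orthogonal c Cc with C⊆ Cc
    ... | α , refl = ⊥C α
    excluded : ¬ (y ≡ 0w ⊎ Wt12 y ⊎ y ≡ 1w)
    excluded (inj₁ y≡0)        = y≢0 y≡0
    excluded (inj₂ (inj₁ wt))  = A1d y wt orthogonal
    excluded (inj₂ (inj₂ refl)) with trans (sym (dot-0w++1w m)) (orthogonal _ c111)
    ... | ()

-- Dimension of the 3-sum

module ThreeSum {m m' : ℕ} (C : LinearCode (m + 3)) (C' : LinearCode (3 + m')) where

  N : ℕ
  N = (m + 3) + (3 + m')

  glue : Word m → Word 3 → Word m' → Word N
  glue u x v = (u ++ x) ++ (x ++ v)

  left : Word N → Word m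
  left w = take m (take (m + 3) w)

  centre : Word N → Word 3
  centre w = drop m (take (m + 3) w)

  centre′ : Word N → Word 3
  centre′ w = take 3 (drop (m + 3) w)

  right : Word N → Word m'
  right w = drop 3 (drop (m + 3) w)

  mid : Word N → Word 3
  mid w = centre w ⊕ centre′ w

  outer : Word N → Word (m + m')
  outer w = left w ++ right w

  mid-linear : IsLinear mid
  mid-linear x y = begin
    centre (x ⊕ y) ⊕ centre′ (x ⊕ y)                 ≡⟨ cong₂ _⊕_ centre-⊕ centre′-⊕ ⟩
    (centre x ⊕ centre y) ⊕ (centre′ x ⊕ centre′ y)   ≡⟨ ⊕-interchange (centre x) _ _ _ ⟩
    mid x ⊕ mid y                                     ∎
    where
    open ≡-Reasoning
    centre-⊕ : centre (x ⊕ y) ≡ centre x ⊕ centre y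
    centre-⊕ = trans (cong (drop m) (take-⊕ (m + 3) x y)) (drop-⊕ m (take (m + 3) x) _)
    centre′-⊕ : centre′ (x ⊕ y) ≡ centre′ x ⊕ centre′ y
    centre′-⊕ = trans (cong (take 3) (drop-⊕ (m + 3) x y)) (take-⊕ 3 (drop (m + 3) x) _)

  outer-linear : IsLinear outer
  outer-linear x y = begin
    left (x ⊕ y) ++ right (x ⊕ y)                    ≡⟨ cong₂ _++_ left-⊕ right-⊕ ⟩
    (left x ⊕ left y) ++ (right x ⊕ right y)         ≡⟨ sym (++-⊕ (left x) _ (right x) _) ⟩
    outer x ⊕ outer y                                ∎
    where
    open ≡-Reasoning
    left-⊕ : left (x ⊕ y) ≡ left x ⊕ left y
    left-⊕ = trans (cong (take m) (take-⊕ (m + 3) x y)) (take-⊕ m (take (m + 3) x) _)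
    right-⊕ : right (x ⊕ y) ≡ right x ⊕ right y
    right-⊕ = trans (cong (drop 3) (drop-⊕ (m + 3) x y)) (drop-⊕ 3 (drop (m + 3) x) _)

  take-glue : ∀ u x v → take (m + 3) (glue u x v) ≡ u ++ x
  take-glue u x v = take-++ (u ++ x) (x ++ v)

  drop-glue : ∀ u x v → drop (m + 3) (glue u x v) ≡ x ++ v
  drop-glue u x v = drop-++ (u ++ x) (x ++ v)

  mid-glue : ∀ u x v → mid (glue u x v) ≡ 0w
  mid-glue u x v = begin
    centre (glue u x v) ⊕ centre′ (glue u x v)   ≡⟨ cong₂ _⊕_ (trans (cong (drop m) (take-glue u x v)) (drop-++ u x))
                                                               (trans (cong (take 3) (drop-glue u x v)) (take-++ x v)) ⟩
    x ⊕ x                                       ≡⟨ ⊕-self x ⟩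
    0w                                          ∎
    where open ≡-Reasoning

  outer-glue : ∀ u x v → outer (glue u x v) ≡ u ++ v
  outer-glue u x v = cong₂ _++_ (trans (cong (take m) (take-glue u x v)) (take-++ u x))
                                (trans (cong (drop 3) (drop-glue u x v)) (drop-++ x v))

  mid≡0w⇒glue : ∀ w → mid w ≡ 0w → w ≡ glue (left w) (centre w) (right w)
  mid≡0w⇒glue w mw = begin
    w                                                   ≡⟨ sym (take++drop≡id (m + 3) w) ⟩
    take (m + 3) w ++ drop (m + 3) w                    ≡⟨ cong₂ _++_ (sym (take++drop≡id m _)) (sym (take++drop≡id 3 _)) ⟩
    (left w ++ centre w) ++ (centre′ w ++ right w)      ≡⟨ cong (λ x → (left w ++ centre w) ++ (x ++ right w))
                                                             (sym (⊕≡0w⇒≡ (centre w) _ mw)) ⟩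
    glue (left w) (centre w) (right w)                  ∎
    where open ≡-Reasoning

  Glued : Code N
  Glued = (_∈C C ⊗ _∈C C') ∩ (λ w → mid w ≡ 0w)

  glue-∈ : ∀ u x v → _∈C C (u ++ x) → _∈C C' (x ++ v) → Glued (glue u x v)
  glue-∈ u x v Cux C'xv =
    (subst (_∈C C) (sym (take-glue u x v)) Cux , subst (_∈C C') (sym (drop-glue u x v)) C'xv) , mid-glue u x v

  ∈-glue : ∀ {w} → Glued w → _∈C C (left w ++ centre w) × _∈C C' (centre w ++ right w)
  ∈-glue {w} ((Cw , C'w) , mw) =
    subst (_∈C C) (trans (cong (take (m + 3)) (mid≡0w⇒glue w mw)) (take-glue (left w) (centre w) (right w))) Cw ,
    subst (_∈C C') (trans (cong (drop (m + 3)) (mid≡0w⇒glue w mw)) (drop-glue (left w) (centre w) (right w))) C'w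

  threeSum≐outer : threeSum (_∈C C) (_∈C C') ≐ Image outer Glued
  proj₁ threeSum≐outer (u , v , x , refl , Cux , C'xv) = glue u x v , glue-∈ u x v Cux C'xv , outer-glue u x v
  proj₂ threeSum≐outer (w , Gw , refl) = left w , right w , centre w , refl , ∈-glue Gw

  z : Word N
  z = glue 0w 1w 0w

  z≢0w : ¬ z ≡ 0w
  z≢0w eq with ++-injectiveʳ (0w {m} ++ 1w) 0w (trans eq (0w-++ (m + 3)))
  ... | ()

  outer-z : outer z ≡ 0w
  outer-z = trans (outer-glue 0w 1w 0w) (sym (0w-++ m))

  glue-0w : glue 0w 0w 0w ≡ 0w
  glue-0w = sym (trans (0w-++ (m + 3)) (cong₂ _++_ (0w-++ m) (0w-++ 3)))

  outer-kernel : NoTailWt12 (_∈C C) → ∀ {w} → Glued w → outer w ≡ 0w → w ≡ 0w ⊎ w ≡ z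
  outer-kernel A1 {w} Gw ow with ++-injective (left w) 0w (trans ow (0w-++ m))
  ... | l≡0 , r≡0 = by-centre (Word3-cases (centre w))
    where
    w≡glue : w ≡ glue 0w (centre w) 0w
    w≡glue = trans (mid≡0w⇒glue w (proj₂ Gw)) (cong₂ (λ u v → glue u (centre w) v) l≡0 r≡0)
    by-centre : centre w ≡ 0w ⊎ Wt12 (centre w) ⊎ centre w ≡ 1w → w ≡ 0w ⊎ w ≡ z
    by-centre (inj₁ x≡0)        = inj₁ (trans w≡glue (trans (cong (λ x → glue 0w x 0w) x≡0) glue-0w))
    by-centre (inj₂ (inj₁ wt))  = ⊥-elim (A1 (centre w) wt (subst (λ u → _∈C C (u ++ centre w)) l≡0 (proj₁ (∈-glue Gw))))
    by-centre (inj₂ (inj₂ x≡1)) = inj₂ (trans w≡glue (cong (λ x → glue 0w x 0w) x≡1))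

  z∈Glued : _∈C C (0w {m} ++ 1w) → _∈C C' (1w ++ 0w {m'}) → Glued z
  z∈Glued = glue-∈ 0w 1w 0w

  mid-onto : ∀ {k} → Dim (_∈C C) k → NoTailWt12 (dual (_∈C C)) → _∈C C (0w {m} ++ 1w) →
             ∀ e → Image mid (_∈C C ⊗ _∈C C') e
  mid-onto dimC A1d c111 e with drop-surjective m C dimC A1d c111 e
  ... | c , Cc , refl =
    c ++ 0w , (subst (_∈C C) (sym (take-++ c 0w)) Cc , subst (_∈C C') (sym (drop-++ c 0w)) (zero∈ C')) ,
    trans (cong₂ _⊕_ (cong (drop m) (take-++ c 0w)) (cong (take 3) (drop-++ c 0w))) (⊕-identityʳ (drop m c))

  Dim-Glued : ∀ {k k'} → NoTailWt12 (dual (_∈C C)) → _∈C C (0w {m} ++ 1w) →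
              HasDim (_∈C C) k → HasDim (_∈C C') k' → ∃[ r ] 3 + r ≡ k + k' × Dim Glued r
  Dim-Glued A1d c111 hC hC' =
    Dim-kernel-surjective mid mid-linear (Dim-⊗ (HasDim⇒Dim C hC) (HasDim⇒Dim C' hC'))
                          (mid-onto (HasDim⇒Dim C hC) A1d c111)

  Dim-outer : ∀ {r} → NoTailWt12 (_∈C C) → _∈C C (0w {m} ++ 1w) → _∈C C' (1w ++ 0w {m'}) →
              Dim Glued r → ∃[ j ] suc j ≡ r × Dim (Image outer Glued) j
  Dim-outer A1 c111 c'111 dimGlued =
    Dim-image outer outer-linear dimGlued (z∈Glued c111 c'111) z≢0w outer-z (outer-kernel A1)

  threeSum-dim : ∀ {k k'} → NoTailWt12 (_∈C C) → NoTailWt12 (dual (_∈C C)) →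
                 _∈C C (0w {m} ++ 1w) → _∈C C' (1w ++ 0w {m'}) →
                 HasDim (_∈C C) k → HasDim (_∈C C') k' →
                 ∃[ j ] j + 4 ≡ k + k' × HasDim (threeSum (_∈C C) (_∈C C')) j
  threeSum-dim {k} {k'} A1 A1d c111 c'111 hC hC' = from-Glued (Dim-Glued A1d c111 hC hC')
    where
    from-Glued : ∃[ r ] 3 + r ≡ k + k' × Dim Glued r →
                 ∃[ j ] j + 4 ≡ k + k' × HasDim (threeSum (_∈C C) (_∈C C')) j
    from-Glued (r , 3+r≡ , dimGlued) with Dim-outer A1 c111 c'111 dimGlued
    ... | j , 1+j≡r , dimOuter =
      j , trans (+-comm j 4) (trans (cong (3 +_) 1+j≡r) 3+r≡) ,
      Dim⇒HasDim (Dim-cong (≐-sym threeSum≐outer) dimOuter)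

-- Minimum distance

weight-0w : ∀ n → weight (0w {n}) ≡ 0
weight-0w zero    = refl
weight-0w (suc n) = weight-0w n

weight-++0w : ∀ {m} (y : Word m) → weight (y ++ 0w {n}) ≡ weight y
weight-++0w {n = n} []          = weight-0w n
weight-++0w         (true  ∷ y) = cong suc (weight-++0w y)
weight-++0w         (false ∷ y) = weight-++0w y

weight-0w++ : ∀ m (y : Word n) → weight (0w {m} ++ y) ≡ weight y
weight-0w++ zero    y = refl
weight-0w++ (suc m) y = weight-0w++ m y

IsMinDist-embedding : ∀ {n₁} {D : Code n} {D₁ : Code n₁} (f : Word n₁ → Word n) →
                      (∀ y → f y ≡ 0w → y ≡ 0w) → (∀ y → weight (f y) ≡ weight y) → (∀ {y} → D₁ y → D (f y)) →
                      ∀ d d₁ → IsMinDist D d → IsMinDist D₁ d₁ → d ≤∞ d₁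
IsMinDist-embedding f f-0 f-wt emb (just e) (just a) (_ , minimal) ((y , D₁y , y≢0 , wy) , _) =
  subst (e ≤_) (trans (f-wt y) wy) (minimal (f y) (emb D₁y) (λ fy≡0 → y≢0 (f-0 y fy≡0)))
IsMinDist-embedding f f-0 f-wt emb (just e) nothing  _ _ = tt
IsMinDist-embedding f f-0 f-wt emb nothing  (just a) trivial ((y , D₁y , y≢0 , _) , _) =
  y≢0 (f-0 y (trivial (f y) (emb D₁y)))
IsMinDist-embedding f f-0 f-wt emb nothing  nothing  _ _ = tt

≤∞-min∞ : ∀ d d₁ d₂ → d ≤∞ d₁ → d ≤∞ d₂ → d ≤∞ min∞ d₁ d₂
≤∞-min∞ d        nothing  d₂       _  h₂ = h₂
≤∞-min∞ d        (just a) nothing  h₁ _  = h₁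
≤∞-min∞ (just e) (just a) (just b) h₁ h₂ = ⊓-glb h₁ h₂
≤∞-min∞ nothing  (just a) (just b) () _

threeSum-minDist : ∀ {m m'} (C : LinearCode (m + 3)) (C' : LinearCode (3 + m')) (d d₁ d₂ : ℕ∞) →
                   IsMinDist (threeSum (_∈C C) (_∈C C')) d →
                   IsMinDist (shortenLast3 (_∈C C)) d₁ → IsMinDist (shortenFirst3 (_∈C C')) d₂ →
                   d ≤∞ min∞ d₁ d₂
threeSum-minDist {m} {m'} C C' d d₁ d₂ hd h₁ h₂ = ≤∞-min∞ d d₁ d₂
  (IsMinDist-embedding (_++ 0w) ++0w≡0w⇒ (weight-++0w {n = m'})
     (λ {y} Cy → y , 0w , 0w , refl , Cy , subst (_∈C C') (0w-++ 3) (zero∈ C')) d d₁ hd h₁)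
  (IsMinDist-embedding (0w ++_) 0w++≡0w⇒ (weight-0w++ m)
     (λ {y} C'y → 0w , y , 0w , refl , subst (_∈C C) (0w-++ m) (zero∈ C) , C'y) d d₂ hd h₂)
  where
  ++0w≡0w⇒ : ∀ y → y ++ 0w ≡ 0w → y ≡ 0w
  ++0w≡0w⇒ y eq = ++-injectiveˡ y 0w (trans eq (0w-++ m))
  0w++≡0w⇒ : ∀ y → 0w ++ y ≡ 0w → y ≡ 0w
  0w++≡0w⇒ y eq = ++-injectiveʳ (0w {m}) 0w (trans eq (0w-++ m))

proposition4p12 : ∀ (m m' : ℕ) → 4 ≤ m → 4 ≤ m' →
    (C : LinearCode (m + 3)) → (C' : LinearCode (3 + m')) →
    NoTailWt12 (_∈C C) → NoTailWt12 (dual (_∈C C)) →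
    NoHeadWt12 (_∈C C') → NoHeadWt12 (dual (_∈C C')) →
    _∈C C (0w {m} ++ 1w) → _∈C C' (1w ++ 0w {m'}) →
    (∀ (k k' : ℕ) → HasDim (_∈C C) k → HasDim (_∈C C') k' →
       Σ ℕ λ j → (j + 4 ≡ k + k') × HasDim (threeSum (_∈C C) (_∈C C')) j)
    × (∀ (d d₁ d₂ : ℕ∞) → IsMinDist (threeSum (_∈C C) (_∈C C')) d →
       IsMinDist (shortenLast3 (_∈C C)) d₁ → IsMinDist (shortenFirst3 (_∈C C')) d₂ →
       d ≤∞ min∞ d₁ d₂)
proposition4p12 m m' _ _ C C' A1 A1d _ _ c111 c'111 =
  (λ k k' → ThreeSum.threeSum-dim C C' A1 A1d c111 c'111) , threeSum-minDist C C'
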